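{- Let $V=[n]$, $k\ge1$, $\varepsilon\in(0,1)$, positive integers $B_1,\dots,B_k$ with $B=\sum_iB_i\le n$, and let $F:(k+1)^V\to\mathbb{R}_{\ge0}$ be $\varepsilon$-approximately diminishing returns. Let $\mathbf{x}^{(0)},\dots,\mathbf{x}^{(B)}$ and $(e^{(j)},i^{(j)})$ be the iterates and selected pairs of $k$-Greedy-IS run on $F$, let $\mathbf{o}$ be an optimal solution of $\max\{F(\mathbf{y}):|\mathrm{supp}_i(\mathbf{y})|\le B_i\ \forall i\}$ with $|\mathrm{supp}_i(\mathbf{o})|=B_i$ for all $i$, and let $\mathbf{o}^{(0)},\dots,\mathbf{o}^{(B)}$ be constructed as in the context. Then for every $j\in[B]$, $2\left[F(\mathbf{x}^{(j)})-F(\mathbf{x}^{(j-1)})\right]\ge\frac{1-\varepsilon}{1+\varepsilon}\left[F(\mathbf{o}^{(j-1)})-F(\mathbf{o}^{(j)})\right]$.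
   Context: $(k+1)^V$ is the set of $k$-tuples $(X_1,\dots,X_k)$ of pairwise disjoint subsets of $V$, identified with $\mathbf{x}\in\{0,\dots,k\}^V$ via $\mathbf{x}(e)=i\iff e\in X_i$; $\mathrm{supp}(\mathbf{x})=\{e:\mathbf{x}(e)\ne0\}$, $\mathrm{supp}_i(\mathbf{x})=\{e:\mathbf{x}(e)=i\}$; $\mathbf{x}\preceq\mathbf{y}$ iff $X_i\subseteq Y_i$ $\forall i$; $\Delta_{u,i}g(\mathbf{x})=g(X_1,\dots,X_i\cup\{u\},\dots,X_k)-g(\mathbf{x})$. $k$-submodular: $\Delta_{u,i}f(\mathbf{x})\ge\Delta_{u,i}f(\mathbf{y})$ for $\mathbf{x}\preceq\mathbf{y}$, $u\notin\mathrm{supp}(\mathbf{y})$, and $\Delta_{u,i}f(\mathbf{x})+\Delta_{u,j}f(\mathbf{x})\ge0$ for $i\ne j$; monotone: $\mathbf{x}\preceq\mathbf{y}\Rightarrow f(\mathbf{x})\le f(\mathbf{y})$. $F$ is $\varepsilon$-approximately diminishing returns if there is a monotone $k$-submodular $f$ with $f(\mathbf{0})=0$ and $(1-\varepsilon)\Delta_{u,i}f(\mathbf{x})\le\Delta_{u,i}F(\mathbf{x})\le(1+\varepsilon)\Delta_{u,i}f(\mathbf{x})$ for all $\mathbf{x}$, $u\notin\mathrm{supp}(\mathbf{x})$, $i$; $F(\mathbf{0})=0$. $k$-Greedy-IS: $\mathbf{x}^{(0)}=\mathbf{0}$, $I=[k]$; at step $j$ pick $(e^{(j)},i^{(j)})\in\arg\max_{e\notin\mathrm{supp}(\mathbf{x}^{(j-1)}),i\in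 I}\Delta_{e,i}F(\mathbf{x}^{(j-1)})$, let $\mathbf{x}^{(j)}$ be $\mathbf{x}^{(j-1)}$ with $e^{(j)}$ assigned $i^{(j)}$, and remove $i^{(j)}$ from $I$ once $|\mathrm{supp}_{i^{(j)}}(\mathbf{x}^{(j)})|=B_{i^{(j)}}$; it stops after $B$ steps. Construction: $\mathbf{o}^{(0)}=\mathbf{o}$; for $j\in[B]$ let $S_i^{(j)}=\mathrm{supp}_i(\mathbf{o}^{(j-1)})\setminus\mathrm{supp}_i(\mathbf{x}^{(j-1)})$. Case C1: some $i'\ne i^{(j)}$ has $e^{(j)}\in S_{i'}^{(j)}$. Let $u_j$ be an arbitrary element of $S_{i^{(j)}}^{(j)}$; $\mathbf{o}^{(j-1/2)}$ is $\mathbf{o}^{(j-1)}$ with coordinates $e^{(j)}$ and $u_j$ set to $0$; $\mathbf{o}^{(j)}$ is $\mathbf{o}^{(j-1/2)}$ with coordinate $e^{(j)}$ set to $i^{(j)}$ and coordinate $u_j$ set to $i'$. Case C2: no such $i'$. Let $u_j=e^{(j)}$ if $e^{(j)}\in S_{i^{(j)}}^{(j)}$, otherwise an arbitrary element of $S_{i^{(j)}}^{(j)}$; $\mathbf{o}^{(j-1/2)}$ is $\mathbf{o}^{(j-1)}$ with coordinate $u_j$ set to $0$; $\mathbf{o}^{(j)}$ is $\mathbf{o}^{(j-1/2)}$ with coordinate $e^{(j)}$ set to $i^{(j)}$. -}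

module Defs where

open import Level using (0ℓ)
open import Data.Nat as ℕ using (ℕ; zero; suc)
open import Data.Fin as Fin using (Fin; zero; suc)
open import Data.Fin.Properties using () renaming (_≟_ to _≟ᶠ_)
open import Data.Vec using (Vec; lookup; replicate; count; _[_]≔_)
open import Data.Bool using (Bool; true; false; _∧_; not)
open import Data.Product using (Σ; _×_; _,_)
open import Data.Sum using (_⊎_)
open import Relation.Nullary using (¬_; ⌊_⌋)
open import Relation.Binary using (Rel; IsTotalOrder)
open import Relation.Binary.PropositionalEquality using (_≡_; _≢_)
open import Algebra.Bundles using (CommutativeRing)

-- Ordered fields (the paper works in ℝ; we state the lemma for an
-- arbitrary ordered field, of which ℝ is an instance).

record OrderedField : Set₁ where
  field
    commutativeRing : CommutativeRing 0ℓ 0ℓ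
  open CommutativeRing commutativeRing public
  field
    _≤_          : Rel Carrier 0ℓ
    isTotalOrder : IsTotalOrder _≈_ _≤_
    +-monoˡ-≤    : ∀ {x y} z → x ≤ y → (x + z) ≤ (y + z)
    *-nonneg     : ∀ {x y} → 0# ≤ x → 0# ≤ y → 0# ≤ (x * y)
    0≉1          : ¬ (0# ≈ 1#)
    _⁻¹          : Carrier → Carrier
    ⁻¹-inverse   : ∀ x → ¬ (x ≈ 0#) → (x * (x ⁻¹)) ≈ 1#

  _<_ : Rel Carrier 0ℓ
  x < y = (x ≤ y) × ¬ (x ≈ y)

  _/_ : Carrier → Carrier → Carrier
  x / y = x * (y ⁻¹)

  2# : Carrier
  2# = 1# + 1#

-- (k+1)^V with V = [n]: vectors over Fin (suc k);
-- entry zero = unassigned, entry (suc i) = element lies in X_i (i : Fin k).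

Sol : ℕ → ℕ → Set
Sol n k = Vec (Fin (suc k)) n

module _ {n k : ℕ} where

  zeroSol : Sol n k
  zeroSol = replicate n zero

  cnt : Sol n k → Fin k → ℕ
  cnt x i = count (λ a → a ≟ᶠ suc i) x

  NotInSupp : Sol n k → Fin n → Set
  NotInSupp x e = lookup x e ≡ zero

  _⪯_ : Sol n k → Sol n k → Set
  x ⪯ y = ∀ e i → lookup x e ≡ suc i → lookup y e ≡ suc i

  add : Sol n k → Fin n → Fin k → Sol n k
  add x u i = x [ u ]≔ suc i

  Feasible : (Fin k → ℕ) → Sol n k → Set
  Feasible B y = ∀ i → cnt y i ℕ.≤ B i

  -- the set I of k-Greedy-IS before step j+1 (i.e. after j steps),
  -- as a characteristic function; xs j = x^(j), is j = i^(j) (j ≥ 1).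
  avail : (Fin k → ℕ) → (ℕ → Sol n k) → (ℕ → Fin k) → ℕ → Fin k → Bool
  avail B xs is zero    i = true
  avail B xs is (suc j) i =
    avail B xs is j i ∧ not (⌊ i ≟ᶠ is (suc j) ⌋ ∧ ⌊ cnt (xs (suc j)) (is (suc j)) ℕ.≟ B (is (suc j)) ⌋)

  InS : Sol n k → Sol n k → Fin k → Fin n → Set
  InS oprev xprev i u = (lookup oprev u ≡ suc i) × ¬ (lookup xprev u ≡ suc i)

  ConstrStep : Sol n k → Fin n → Fin k → Sol n k → Sol n k → Set
  ConstrStep xprev e i oprev onext =
    (Σ (Fin k) λ i' → (i' ≢ i) × InS oprev xprev i' e ×
      Σ (Fin n) λ u → InS oprev xprev i u ×
        (onext ≡ ((((oprev [ e ]≔ zero) [ u ]≔ zero) [ e ]≔ suc i) [ u ]≔ suc i')))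
    ⊎
    ((¬ (Σ (Fin k) λ i' → (i' ≢ i) × InS oprev xprev i' e)) ×
      Σ (Fin n) λ u → (InS oprev xprev i e → u ≡ e) ×
                      (¬ InS oprev xprev i e → InS oprev xprev i u) ×
        (onext ≡ ((oprev [ u ]≔ zero) [ e ]≔ suc i)))

module _ (R : OrderedField) {n k : ℕ} where
  open OrderedField R using (Carrier; _≈_; _≤_; _+_; _*_; _-_; 0#; 1#)

  Δ : (Sol n k → Carrier) → Sol n k → Fin n → Fin k → Carrier
  Δ g x u i = g (add x u i) - g x

  Monotone : (Sol n k → Carrier) → Set
  Monotone f = ∀ x y → x ⪯ y → f x ≤ f y

  KSubmodular : (Sol n k → Carrier) → Set
  KSubmodular f =
    (∀ x y → x ⪯ y → ∀ u → NotInSupp y u → ∀ i → Δ f y u i ≤ Δ f x u i) ×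
    (∀ x u → NotInSupp x u → ∀ i j → i ≢ j → 0# ≤ (Δ f x u i + Δ f x u j))

  ApproxDR : Carrier → (Sol n k → Carrier) → Set
  ApproxDR ε F =
    (F zeroSol ≈ 0#) ×
    Σ (Sol n k → Carrier) λ f →
      Monotone f × KSubmodular f × (f zeroSol ≈ 0#) ×
      (∀ x u → NotInSupp x u → ∀ i →
        (((1# - ε) * Δ f x u i) ≤ Δ F x u i) × (Δ F x u i ≤ ((1# + ε) * Δ f x u i)))

  -- (xs, es, is) is a run of k-Greedy-IS on F for BT steps:
  -- xs j = x^(j), es j = e^(j), is j = i^(j) for 1 ≤ j ≤ BT.
  GreedyRun : (Fin k → ℕ) → ℕ → (Sol n k → Carrier) →
              (ℕ → Sol n k) → (ℕ → Fin n) → (ℕ → Fin k) → Set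
  GreedyRun B BT F xs es is =
    (xs zero ≡ zeroSol) ×
    (∀ j → j ℕ.< BT →
      NotInSupp (xs j) (es (suc j)) ×
      (avail B xs is j (is (suc j)) ≡ true) ×
      (∀ e i → NotInSupp (xs j) e → avail B xs is j i ≡ true →
         Δ F (xs j) e i ≤ Δ F (xs j) (es (suc j)) (is (suc j))) ×
      (xs (suc j) ≡ add (xs j) (es (suc j)) (is (suc j))))

  Optimal : (Fin k → ℕ) → (Sol n k → Carrier) → Sol n k → Set
  Optimal B F o = Feasible B o × (∀ y → Feasible B y → F y ≤ F o)

sumFin : {k : ℕ} → (Fin k → ℕ) → ℕ
sumFin {zero}  B = 0
sumFin {suc k} B = B zero ℕ.+ sumFin (λ i → B (suc i))

{-# OPTIONS --safe #-}
module Submission where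

-- The construction keeps x^(j) ⪯ o^(j) and |supp_i(o^(j))| = B_i.  In each step,
-- o^(j-1) and o^(j) are built from a common solution a ⪰ x^(j-1) by placing one element
-- (case C2) or the same two elements with their labels exchanged (case C1).  Marginals
-- of F are nonnegative, so F(a) ≤ F(o^(j)) and F(o^(j-1)) - F(o^(j)) is at most the sum
-- of the marginals that build o^(j-1) from a.  Scaled by (1-ε)/(1+ε), each of them is at
-- most a marginal at x^(j-1) by approximate diminishing returns, and greedy bounds that by
-- F(x^(j)) - F(x^(j-1)): in case C1 the label i' of e^(j) is still available, since
-- o^(j-1) has exactly B_i' elements of label i' and e^(j) is not yet one of x^(j-1)'s.
-- Only monotonicity and diminishing returns of f enter.

open import Level using (0ℓ)
open import Defs
open import Data.Nat as ℕ using (ℕ; zero; suc; z≤n; s≤s)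
import Data.Nat.Properties as ℕₚ
open import Data.Fin using (Fin; zero; suc)
open import Data.Fin.Properties using (suc-injective; 0≢1+n) renaming (_≟_ to _≟ᶠ_)
open import Data.Vec using (Vec; []; _∷_; [_]; lookup; count; _[_]≔_)
open import Data.Vec.Properties
  using (lookup∘update; lookup∘update′; lookup-replicate; []≔-idempotent; []≔-commutes; []≔-lookup)
open import Data.Bool using (true; false)
open import Data.Product using (_×_; _,_; proj₁; proj₂)
open import Data.Sum using (inj₁; inj₂)
open import Function using (_∘_)
open import Relation.Nullary using (¬_; yes; no; contradiction)
open import Relation.Unary using (Pred; Decidable)
open import Relation.Binary.Bundles using (Poset)
open import Relation.Binary.Structures using (IsTotalOrder)
open import Relation.Binary.PropositionalEquality
  using (_≡_; _≢_; refl; sym; trans; cong; subst; module ≡-Reasoning)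
open import Algebra.Properties.CommutativeSemigroup ℕₚ.+-commutativeSemigroup using (xy∙z≈xz∙y)

module _ {a p} {A : Set a} {P : Pred A p} (P? : Decidable P) where
  open import Data.Nat.Base using (_+_)

  count-mono : ∀ {n} (v w : Vec A n) → (∀ t → P (lookup v t) → P (lookup w t)) →
               count P? v ℕ.≤ count P? w
  count-mono []      []      _ = z≤n
  count-mono (x ∷ v) (y ∷ w) h with P? x | P? y
  ... | yes _  | yes _  = s≤s (count-mono v w (h ∘ suc))
  ... | yes Px | no ¬Py = contradiction (h zero Px) ¬Py
  ... | no _   | yes _  = ℕₚ.m≤n⇒m≤1+n (count-mono v w (h ∘ suc))
  ... | no _   | no _   = count-mono v w (h ∘ suc)

  count-strict : ∀ {n} (v w : Vec A n) → (∀ t → P (lookup v t) → P (lookup w t)) →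
                 ∀ t → P (lookup w t) → ¬ P (lookup v t) → count P? v ℕ.< count P? w
  count-strict (x ∷ v) (y ∷ w) h zero Py ¬Px with P? x | P? y
  ... | yes Px | _      = contradiction Px ¬Px
  ... | no _   | yes _  = s≤s (count-mono v w (h ∘ suc))
  ... | no _   | no ¬Py = contradiction Py ¬Py
  count-strict (x ∷ v) (y ∷ w) h (suc t) Py ¬Px with P? x | P? y
  ... | yes _  | yes _  = s≤s (count-strict v w (h ∘ suc) t Py ¬Px)
  ... | yes Px | no ¬Py = contradiction (h zero Px) ¬Py
  ... | no _   | yes _  = ℕₚ.m≤n⇒m≤1+n (count-strict v w (h ∘ suc) t Py ¬Px)
  ... | no _   | no _   = count-strict v w (h ∘ suc) t Py ¬Px

  count-[]≔ : ∀ {n} (v : Vec A n) w b →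
              count P? (v [ w ]≔ b) + count P? [ lookup v w ] ≡ count P? v + count P? [ b ]
  count-[]≔ (x ∷ v) zero b with P? b | P? x
  ... | yes _ | yes _ = refl
  ... | yes _ | no _  = trans (ℕₚ.+-identityʳ _) (ℕₚ.+-comm 1 (count P? v))
  ... | no _  | yes _ = sym (trans (ℕₚ.+-identityʳ _) (ℕₚ.+-comm 1 (count P? v)))
  ... | no _  | no _  = refl
  count-[]≔ (x ∷ v) (suc w) b with P? x
  ... | yes _ = cong suc (count-[]≔ v w b)
  ... | no _  = count-[]≔ v w b

module _ {a} {A : Set a} where

  []≔-restore : ∀ {n} (v : Vec A n) {w b} c → lookup v w ≡ b → (v [ w ]≔ c) [ w ]≔ b ≡ v
  []≔-restore v {w} c refl = trans ([]≔-idempotent v w) ([]≔-lookup v w)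

  []≔-restore₂ : ∀ {n} (v : Vec A n) {w₁ w₂ b₁ b₂} c₁ c₂ → w₁ ≢ w₂ →
                 lookup v w₁ ≡ b₁ → lookup v w₂ ≡ b₂ →
                 (((v [ w₁ ]≔ c₁) [ w₂ ]≔ c₂) [ w₁ ]≔ b₁) [ w₂ ]≔ b₂ ≡ v
  []≔-restore₂ v {w₁} {w₂} {b₁} {b₂} c₁ c₂ w₁≢w₂ v₁ v₂ = begin
    (((v [ w₁ ]≔ c₁) [ w₂ ]≔ c₂) [ w₁ ]≔ b₁) [ w₂ ]≔ b₂
      ≡⟨ cong (_[ w₂ ]≔ b₂) ([]≔-commutes (v [ w₁ ]≔ c₁) w₂ w₁ (w₁≢w₂ ∘ sym)) ⟩
    (((v [ w₁ ]≔ c₁) [ w₁ ]≔ b₁) [ w₂ ]≔ c₂) [ w₂ ]≔ b₂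
      ≡⟨ cong (λ v′ → (v′ [ w₂ ]≔ c₂) [ w₂ ]≔ b₂) ([]≔-restore v c₁ v₁) ⟩
    (v [ w₂ ]≔ c₂) [ w₂ ]≔ b₂
      ≡⟨ []≔-restore v c₂ v₂ ⟩
    v ∎
    where open ≡-Reasoning

module _ {n k : ℕ} where
  open import Data.Nat.Base using (_+_)

  zeroSol-⪯ : (y : Sol n k) → zeroSol ⪯ y
  zeroSol-⪯ y t l 0≡l = contradiction (trans (sym (lookup-replicate t zero)) 0≡l) 0≢1+n

  ⪯-trans : (x y z : Sol n k) → x ⪯ y → y ⪯ z → x ⪯ z
  ⪯-trans _ _ _ x⪯y y⪯z t l = y⪯z t l ∘ x⪯y t l

  notInSupp⇒≢suc : ∀ (x : Sol n k) {w l} → NotInSupp x w → lookup x w ≢ suc l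
  notInSupp⇒≢suc _ xw = 0≢1+n ∘ trans (sym xw)

  ⪯-notInSupp : ∀ (x y : Sol n k) {w} → x ⪯ y → NotInSupp y w → NotInSupp x w
  ⪯-notInSupp x y {w} x⪯y yw with lookup x w in xw
  ... | zero  = refl
  ... | suc l = contradiction (x⪯y w l xw) (notInSupp⇒≢suc y yw)

  InS⇒notInSupp : ∀ (x y : Sol n k) {l u} → x ⪯ y → InS y x l u → NotInSupp x u
  InS⇒notInSupp x y {u = u} x⪯y (yu , xu≢) with lookup x u in xu
  ... | zero   = refl
  ... | suc l′ = contradiction (cong suc (suc-injective (trans (sym (x⪯y u l′ xu)) yu))) xu≢

  add-notInSupp : ∀ (x : Sol n k) {w u} l → w ≢ u → NotInSupp x u → NotInSupp (add x w l) u
  add-notInSupp x l w≢u xu = trans (lookup∘update′ (w≢u ∘ sym) x (suc l)) xu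

  ⪯-add : ∀ (x : Sol n k) w l → NotInSupp x w → x ⪯ add x w l
  ⪯-add x w l xw t m xt with t ≟ᶠ w
  ... | yes refl = contradiction xt (notInSupp⇒≢suc x xw)
  ... | no t≢w   = trans (lookup∘update′ t≢w x (suc l)) xt

  add-mono-⪯ : ∀ (x y : Sol n k) w l → x ⪯ y → add x w l ⪯ add y w l
  add-mono-⪯ x y w l x⪯y t m xt with t ≟ᶠ w
  ... | yes refl = trans (lookup∘update t y (suc l)) (trans (sym (lookup∘update t x (suc l))) xt)
  ... | no t≢w   = trans (lookup∘update′ t≢w y (suc l))
                         (x⪯y t m (trans (sym (lookup∘update′ t≢w x (suc l))) xt))

  ⪯-clear : ∀ (x y : Sol n k) w → x ⪯ y → NotInSupp x w → x ⪯ (y [ w ]≔ zero)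
  ⪯-clear x y w x⪯y xw t m xt with t ≟ᶠ w
  ... | yes refl = contradiction xt (notInSupp⇒≢suc x xw)
  ... | no t≢w   = trans (lookup∘update′ t≢w y zero) (x⪯y t m xt)

  cnt-mono : ∀ (x y : Sol n k) l → x ⪯ y → cnt x l ℕ.≤ cnt y l
  cnt-mono x y l x⪯y = count-mono (_≟ᶠ suc l) x y (λ t → x⪯y t l)

  cnt-strict : ∀ (x y : Sol n k) {t l} → x ⪯ y → lookup y t ≡ suc l → NotInSupp x t →
               cnt x l ℕ.< cnt y l
  cnt-strict x y {t} {l} x⪯y yt xt =
    count-strict (_≟ᶠ suc l) x y (λ t′ → x⪯y t′ l) t yt (notInSupp⇒≢suc x xt)

  cnt-add : ∀ (x : Sol n k) w l m → NotInSupp x w → cnt (add x w l) m ≡ cnt x m + cnt [ suc l ] m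
  cnt-add x w l m xw =
    trans (sym (ℕₚ.+-identityʳ _))
          (subst (λ b → cnt (add x w l) m + cnt [ b ] m ≡ cnt x m + cnt [ suc l ] m)
                 xw (count-[]≔ (_≟ᶠ suc m) x w (suc l)))

  -- The two shapes of one step of the construction: single covers case C2 (including
  -- e ∈ S_i, where u = e and o′ = o), double covers case C1.  In both, a is o with the
  -- coordinates that change cleared.
  data Exchange (x : Sol n k) (e : Fin n) (i : Fin k) (o o′ : Sol n k) : Set where
    single : ∀ a u → x ⪯ a → NotInSupp a e → NotInSupp a u →
             o ≡ add a u i → o′ ≡ add a e i → Exchange x e i o o′
    double : ∀ a u l → e ≢ u → x ⪯ a → NotInSupp a e → NotInSupp a u →
             o ≡ add (add a e l) u i → o′ ≡ add (add a e i) u l → Exchange x e i o o′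

  constrStep⇒exchange : ∀ {x o o′ : Sol n k} {e i} → x ⪯ o → NotInSupp x e →
                        ConstrStep x e i o o′ → Exchange x e i o o′
  constrStep⇒exchange {x} {o} {e = e} {i} x⪯o xe
                      (inj₁ (l , l≢i , (oe , _) , u , Su@(ou , _) , refl)) =
    double a u l e≢u x⪯a ae (lookup∘update u (o [ e ]≔ zero) zero)
           (sym ([]≔-restore₂ o zero zero e≢u oe ou)) refl
    where
    a : Sol n k
    a = (o [ e ]≔ zero) [ u ]≔ zero
    x⪯a : x ⪯ a
    x⪯a = ⪯-clear x (o [ e ]≔ zero) u (⪯-clear x o e x⪯o xe) (InS⇒notInSupp x o x⪯o Su)
    e≢u : e ≢ u
    e≢u refl = l≢i (suc-injective (trans (sym oe) ou))
    ae : NotInSupp a e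
    ae = trans (lookup∘update′ e≢u (o [ e ]≔ zero) zero) (lookup∘update e o zero)
  constrStep⇒exchange {x} {o} {e = e} {i} x⪯o xe
                      (inj₂ (noC1 , u , Se⇒u≡e , ¬Se⇒Su , refl)) =
    single (o [ u ]≔ zero) u (⪯-clear x o u x⪯o (InS⇒notInSupp x o x⪯o Su)) ae
           (lookup∘update u o zero) (sym ([]≔-restore o zero (proj₁ Su))) refl
    where
    Su : InS o x i u
    Su with lookup o e ≟ᶠ suc i
    ... | yes oe  = subst (InS o x i) (sym (Se⇒u≡e Se)) Se
      where
      Se : InS o x i e
      Se = oe , notInSupp⇒≢suc x xe
    ... | no ¬oe = ¬Se⇒Su (¬oe ∘ proj₁)
    oe≡0 : e ≢ u → lookup o e ≡ zero
    oe≡0 e≢u = unlabelled (lookup o e) refl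
      where
      unlabelled : ∀ b → lookup o e ≡ b → lookup o e ≡ zero
      unlabelled zero    oe = oe
      unlabelled (suc l) oe with l ≟ᶠ i
      ... | yes refl = contradiction (sym (Se⇒u≡e (oe , notInSupp⇒≢suc x xe))) e≢u
      ... | no l≢i   = contradiction (l , l≢i , oe , notInSupp⇒≢suc x xe) noC1
    ae : NotInSupp (o [ u ]≔ zero) e
    ae with e ≟ᶠ u
    ... | yes refl = lookup∘update e o zero
    ... | no e≢u   = trans (lookup∘update′ e≢u o zero) (oe≡0 e≢u)

  exchange-cnt : ∀ {x o o′ : Sol n k} {e i} → Exchange x e i o o′ → ∀ m → cnt o′ m ≡ cnt o m
  exchange-cnt {e = e} {i} (single a u _ ae au refl refl) m =
    trans (cnt-add a e i m ae) (sym (cnt-add a u i m au))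
  exchange-cnt {e = e} {i} (double a u l e≢u _ ae au refl refl) m = begin
    cnt (add (add a e i) u l) m           ≡⟨ cnt-add (add a e i) u l m (add-notInSupp a i e≢u au) ⟩
    cnt (add a e i) m + cnt [ suc l ] m   ≡⟨ cong (_+ cnt [ suc l ] m) (cnt-add a e i m ae) ⟩
    cnt a m + ιᵢ + cnt [ suc l ] m        ≡⟨ xy∙z≈xz∙y (cnt a m) ιᵢ (cnt [ suc l ] m) ⟩
    cnt a m + cnt [ suc l ] m + ιᵢ        ≡⟨ cong (_+ ιᵢ) (cnt-add a e l m ae) ⟨
    cnt (add a e l) m + ιᵢ                ≡⟨ cnt-add (add a e l) u i m (add-notInSupp a l e≢u au) ⟨
    cnt (add (add a e l) u i) m           ∎
    where
    open ≡-Reasoning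
    ιᵢ : ℕ
    ιᵢ = cnt [ suc i ] m

  exchange-⪯ : ∀ {x o o′ : Sol n k} {e i} → Exchange x e i o o′ → add x e i ⪯ o′
  exchange-⪯ {x} {e = e} {i} (single a u x⪯a _ _ _ refl) = add-mono-⪯ x a e i x⪯a
  exchange-⪯ {x} {e = e} {i} (double a u l e≢u x⪯a _ au _ refl) =
    ⪯-trans (add x e i) (add a e i) (add (add a e i) u l)
            (add-mono-⪯ x a e i x⪯a) (⪯-add (add a e i) u l (add-notInSupp a i e≢u au))

  exchange-label : ∀ (a : Sol n k) {e u} l i → e ≢ u → lookup (add (add a e l) u i) e ≡ suc l
  exchange-label a {e} l i e≢u =
    trans (lookup∘update′ e≢u (add a e l) (suc i)) (lookup∘update e a (suc l))

module OrderedFieldProperties (R : OrderedField) where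
  open OrderedField R hiding (zero; refl; sym; trans)
  open IsTotalOrder isTotalOrder using (isPartialOrder; total; antisym)
  open import Algebra.Properties.Group +-group using (//-rightDividesˡ; ⁻¹-involutive; ε⁻¹≈ε)
  open import Algebra.Properties.Ring ring using (x[y-z]≈xy-xz; -‿distribʳ-*; -1*x≈-x)

  poset : Poset 0ℓ 0ℓ 0ℓ
  poset = record { isPartialOrder = isPartialOrder }

  open import Relation.Binary.Reasoning.PartialOrder poset public

  +-monoʳ-≤ : ∀ {x y} z → x ≤ y → (z + x) ≤ (z + y)
  +-monoʳ-≤ {x} {y} z x≤y = begin
    z + x ≈⟨ +-comm z x ⟩
    x + z ≤⟨ +-monoˡ-≤ z x≤y ⟩
    y + z ≈⟨ +-comm y z ⟩
    z + y ∎

  +-mono-≤ : ∀ {x y u v} → x ≤ y → u ≤ v → (x + u) ≤ (y + v)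
  +-mono-≤ {x} {y} {u} {v} x≤y u≤v = begin
    x + u ≤⟨ +-monoˡ-≤ u x≤y ⟩
    y + u ≤⟨ +-monoʳ-≤ y u≤v ⟩
    y + v ∎

  x≤y⇒0≤y-x : ∀ {x y} → x ≤ y → 0# ≤ (y - x)
  x≤y⇒0≤y-x {x} {y} x≤y = begin
    0#    ≈⟨ -‿inverseʳ x ⟨
    x - x ≤⟨ +-monoˡ-≤ (- x) x≤y ⟩
    y - x ∎

  0≤y-x⇒x≤y : ∀ {x y} → 0# ≤ (y - x) → x ≤ y
  0≤y-x⇒x≤y {x} {y} 0≤y-x = begin
    x           ≈⟨ +-identityˡ x ⟨
    0# + x      ≤⟨ +-monoˡ-≤ x 0≤y-x ⟩
    (y - x) + x ≈⟨ //-rightDividesˡ x y ⟩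
    y           ∎

  x≤x+y : ∀ {x y} → 0# ≤ y → x ≤ (x + y)
  x≤x+y {x} {y} 0≤y = begin
    x      ≈⟨ +-identityʳ x ⟨
    x + 0# ≤⟨ +-monoʳ-≤ x 0≤y ⟩
    x + y  ∎

  0≤x+y : ∀ {x y} → 0# ≤ x → 0# ≤ y → 0# ≤ (x + y)
  0≤x+y {x} {y} 0≤x 0≤y = begin
    0#     ≤⟨ 0≤x ⟩
    x      ≤⟨ x≤x+y 0≤y ⟩
    x + y  ∎

  -‿antimono-≤ : ∀ {x y} → x ≤ y → (- y) ≤ (- x)
  -‿antimono-≤ {x} {y} x≤y = 0≤y-x⇒x≤y (begin
    0#        ≤⟨ x≤y⇒0≤y-x x≤y ⟩
    y - x     ≈⟨ +-comm y (- x) ⟩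
    - x + y   ≈⟨ +-congˡ (⁻¹-involutive y) ⟨
    - x - - y ∎)

  x-y≤x-z : ∀ {x y z} → z ≤ y → (x - y) ≤ (x - z)
  x-y≤x-z {x} z≤y = +-monoʳ-≤ x (-‿antimono-≤ z≤y)

  x≤0⇒0≤-x : ∀ {x} → x ≤ 0# → 0# ≤ (- x)
  x≤0⇒0≤-x {x} x≤0 = begin
    0#   ≈⟨ ε⁻¹≈ε ⟨
    - 0# ≤⟨ -‿antimono-≤ x≤0 ⟩
    - x  ∎

  *-monoˡ-≤ : ∀ {c x y} → 0# ≤ c → x ≤ y → (c * x) ≤ (c * y)
  *-monoˡ-≤ {c} {x} {y} 0≤c x≤y = 0≤y-x⇒x≤y (begin
    0#            ≤⟨ *-nonneg 0≤c (x≤y⇒0≤y-x x≤y) ⟩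
    c * (y - x)   ≈⟨ x[y-z]≈xy-xz c y x ⟩
    c * y - c * x ∎)

  [x-z]+[z-y]≈x-y : ∀ x y z → (x - z) + (z - y) ≈ x - y
  [x-z]+[z-y]≈x-y x y z = begin-equality
    (x - z) + (z - y)   ≈⟨ +-assoc x (- z) (z - y) ⟩
    x + (- z + (z - y)) ≈⟨ +-congˡ (+-assoc (- z) z (- y)) ⟨
    x + ((- z + z) - y) ≈⟨ +-congˡ (+-congʳ (-‿inverseˡ z)) ⟩
    x + (0# - y)        ≈⟨ +-congˡ (+-identityˡ (- y)) ⟩
    x - y               ∎

  2*x≈x+x : ∀ x → 2# * x ≈ x + x
  2*x≈x+x x = begin-equality
    (1# + 1#) * x   ≈⟨ distribʳ x 1# 1# ⟩
    1# * x + 1# * x ≈⟨ +-cong (*-identityˡ x) (*-identityˡ x) ⟩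
    x + x           ∎

  0≤1 : 0# ≤ 1#
  0≤1 with total 0# 1#
  ... | inj₁ 0≤1′ = 0≤1′
  ... | inj₂ 1≤0 = begin
    0#          ≤⟨ *-nonneg (x≤0⇒0≤-x 1≤0) (x≤0⇒0≤-x 1≤0) ⟩
    - 1# * - 1# ≈⟨ -1*x≈-x (- 1#) ⟩
    - - 1#      ≈⟨ ⁻¹-involutive 1# ⟩
    1#          ∎

  1≰0 : ¬ (1# ≤ 0#)
  1≰0 1≤0 = 0≉1 (antisym 0≤1 1≤0)

  0≤x⇒0≤x⁻¹ : ∀ {x} → 0# ≤ x → ¬ (x ≈ 0#) → 0# ≤ (x ⁻¹)
  0≤x⇒0≤x⁻¹ {x} 0≤x x≉0 with total 0# (x ⁻¹)
  ... | inj₁ 0≤x⁻¹ = 0≤x⁻¹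
  ... | inj₂ x⁻¹≤0 = contradiction (begin
    1#               ≈⟨ ⁻¹-involutive 1# ⟨
    - - 1#           ≈⟨ -‿cong (-‿cong (⁻¹-inverse x x≉0)) ⟨
    - - (x * x ⁻¹)   ≈⟨ -‿cong (-‿distribʳ-* x (x ⁻¹)) ⟩
    - (x * - x ⁻¹)   ≤⟨ -‿antimono-≤ (*-nonneg 0≤x (x≤0⇒0≤-x x⁻¹≤0)) ⟩
    - 0#             ≈⟨ ε⁻¹≈ε ⟩
    0#               ∎) 1≰0

  x/y*[y*z]≈x*z : ∀ x {y} z → ¬ (y ≈ 0#) → (x / y) * (y * z) ≈ x * z
  x/y*[y*z]≈x*z x {y} z y≉0 = begin-equality
    (x * y ⁻¹) * (y * z) ≈⟨ *-assoc x (y ⁻¹) (y * z) ⟩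
    x * (y ⁻¹ * (y * z)) ≈⟨ *-congˡ (*-assoc (y ⁻¹) y z) ⟨
    x * ((y ⁻¹ * y) * z) ≈⟨ *-congˡ (*-congʳ (*-comm (y ⁻¹) y)) ⟩
    x * ((y * y ⁻¹) * z) ≈⟨ *-congˡ (*-congʳ (⁻¹-inverse y y≉0)) ⟩
    x * (1# * z)         ≈⟨ *-congˡ (*-identityˡ z) ⟩
    x * z                ∎

module _ (R : OrderedField) where
  open OrderedField R hiding (zero; refl; sym; trans)
  open OrderedFieldProperties R

  module GreedyRunProperties
    {n k : ℕ} (B : Fin k → ℕ) (BT : ℕ) (F : Sol n k → Carrier)
    (xs : ℕ → Sol n k) (es : ℕ → Fin n) (is : ℕ → Fin k) (run : GreedyRun R B BT F xs es is)
    where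

    module _ {j : ℕ} (j<BT : j ℕ.< BT) where

      greedy-free : NotInSupp (xs j) (es (suc j))
      greedy-free = proj₁ (proj₂ run j j<BT)

      greedy-avail : avail B xs is j (is (suc j)) ≡ true
      greedy-avail = proj₁ (proj₂ (proj₂ run j j<BT))

      greedy-max : ∀ e l → NotInSupp (xs j) e → avail B xs is j l ≡ true →
                   Δ R F (xs j) e l ≤ Δ R F (xs j) (es (suc j)) (is (suc j))
      greedy-max = proj₁ (proj₂ (proj₂ (proj₂ run j j<BT)))

      greedy-next : xs (suc j) ≡ add (xs j) (es (suc j)) (is (suc j))
      greedy-next = proj₂ (proj₂ (proj₂ (proj₂ run j j<BT)))

      xs-⪯-suc : xs j ⪯ xs (suc j)
      xs-⪯-suc = subst (xs j ⪯_) (sym greedy-next)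
                       (⪯-add (xs j) (es (suc j)) (is (suc j)) greedy-free)

    saturated : ∀ {j l} → j ℕ.≤ BT → avail B xs is j l ≡ false → B l ℕ.≤ cnt (xs j) l
    saturated {zero} _ ()
    saturated {suc j} {l} j<BT unavailable with avail B xs is j l in earlier
    ... | false = ℕₚ.≤-trans (saturated (ℕₚ.<⇒≤ j<BT) earlier)
                             (cnt-mono (xs j) (xs (suc j)) l (xs-⪯-suc j<BT))
    ... | true with l ≟ᶠ is (suc j) | cnt (xs (suc j)) (is (suc j)) ℕ.≟ B (is (suc j))
    ...   | yes refl | yes full = ℕₚ.≤-reflexive (sym full)
    ...   | yes _    | no _     = contradiction unavailable (λ ())
    ...   | no _     | _        = contradiction unavailable (λ ())

    unsaturated⇒avail : ∀ {j l} → j ℕ.≤ BT → cnt (xs j) l ℕ.< B l → avail B xs is j l ≡ true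
    unsaturated⇒avail {j} {l} j≤BT cnt<B with avail B xs is j l in available
    ... | true  = refl
    ... | false = contradiction (saturated j≤BT available) (ℕₚ.<⇒≱ cnt<B)

  module ApproximateDiminishingReturns
    {n k : ℕ} (ε : Carrier) (0≤ε : 0# ≤ ε) (ε≤1 : ε ≤ 1#) (F f : Sol n k → Carrier)
    (f-monotone : Monotone R f)
    (f-diminishing : ∀ x y → x ⪯ y → ∀ u → NotInSupp y u → ∀ i → Δ R f y u i ≤ Δ R f x u i)
    (F≈f : ∀ x u → NotInSupp x u → ∀ i →
             ((1# - ε) * Δ R f x u i) ≤ Δ R F x u i × Δ R F x u i ≤ ((1# + ε) * Δ R f x u i))
    where

    ρ : Carrier
    ρ = (1# - ε) / (1# + ε)

    0≤1-ε : 0# ≤ (1# - ε)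
    0≤1-ε = x≤y⇒0≤y-x ε≤1

    1+ε≉0 : ¬ (1# + ε ≈ 0#)
    1+ε≉0 1+ε≈0 = 1≰0 (begin
      1#     ≤⟨ x≤x+y 0≤ε ⟩
      1# + ε ≈⟨ 1+ε≈0 ⟩
      0#     ∎)

    0≤ρ : 0# ≤ ρ
    0≤ρ = *-nonneg 0≤1-ε (0≤x⇒0≤x⁻¹ (0≤x+y 0≤1 0≤ε) 1+ε≉0)

    ΔF-nonneg : ∀ x {u} i → NotInSupp x u → 0# ≤ Δ R F x u i
    ΔF-nonneg x {u} i xu = begin
      0#                     ≤⟨ *-nonneg 0≤1-ε (x≤y⇒0≤y-x f-step) ⟩
      (1# - ε) * Δ R f x u i ≤⟨ proj₁ (F≈f x u xu i) ⟩
      Δ R F x u i            ∎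
      where
      f-step : f x ≤ f (add x u i)
      f-step = f-monotone x (add x u i) (⪯-add x u i xu)

    F-add-mono : ∀ x {u} i → NotInSupp x u → F x ≤ F (add x u i)
    F-add-mono x i xu = 0≤y-x⇒x≤y (ΔF-nonneg x i xu)

    ρΔF-antitone : ∀ x y {u} i → x ⪯ y → NotInSupp y u → (ρ * Δ R F y u i) ≤ Δ R F x u i
    ρΔF-antitone x y {u} i x⪯y yu = begin
      ρ * Δ R F y u i                ≤⟨ *-monoˡ-≤ 0≤ρ (proj₂ (F≈f y u yu i)) ⟩
      ρ * ((1# + ε) * Δ R f y u i)   ≈⟨ x/y*[y*z]≈x*z (1# - ε) (Δ R f y u i) 1+ε≉0 ⟩
      (1# - ε) * Δ R f y u i         ≤⟨ *-monoˡ-≤ 0≤1-ε (f-diminishing x y x⪯y u yu i) ⟩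
      (1# - ε) * Δ R f x u i         ≤⟨ proj₁ (F≈f x u (⪯-notInSupp x y x⪯y yu) i) ⟩
      Δ R F x u i                    ∎

    single-exchange : ∀ x a {e u} i l → x ⪯ a → NotInSupp a e → NotInSupp a u →
                      (ρ * (F (add a u i) - F (add a e l))) ≤ Δ R F x u i
    single-exchange x a {e} {u} i l x⪯a ae au = begin
      ρ * (F (add a u i) - F (add a e l)) ≤⟨ *-monoˡ-≤ 0≤ρ (x-y≤x-z (F-add-mono a l ae)) ⟩
      ρ * Δ R F a u i                     ≤⟨ ρΔF-antitone x a i x⪯a au ⟩
      Δ R F x u i                         ∎

    double-exchange : ∀ x a {e u} i l → e ≢ u → x ⪯ a → NotInSupp a e → NotInSupp a u →
                      (ρ * (F (add (add a e l) u i) - F (add (add a e i) u l)))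
                        ≤ (Δ R F x u i + Δ R F x e l)
    double-exchange x a {e} {u} i l e≢u x⪯a ae au = begin
      ρ * (F (add b u i) - F (add (add a e i) u l)) ≤⟨ *-monoˡ-≤ 0≤ρ (x-y≤x-z Fa≤) ⟩
      ρ * (F (add b u i) - F a)                     ≈⟨ *-congˡ ([x-z]+[z-y]≈x-y _ _ (F b)) ⟨
      ρ * (Δ R F b u i + Δ R F a e l)               ≈⟨ distribˡ ρ _ _ ⟩
      ρ * Δ R F b u i + ρ * Δ R F a e l             ≤⟨ +-mono-≤ (ρΔF-antitone x b i x⪯b bu)
                                                                 (ρΔF-antitone x a l x⪯a ae) ⟩
      Δ R F x u i + Δ R F x e l                     ∎
      where
      b : Sol n k
      b = add a e l
      x⪯b : x ⪯ b
      x⪯b = ⪯-trans x a b x⪯a (⪯-add a e l ae)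
      bu : NotInSupp b u
      bu = add-notInSupp a l e≢u au
      Fa≤ : F a ≤ F (add (add a e i) u l)
      Fa≤ = begin
        F a                       ≤⟨ F-add-mono a i ae ⟩
        F (add a e i)             ≤⟨ F-add-mono (add a e i) l (add-notInSupp a i e≢u au) ⟩
        F (add (add a e i) u l)   ∎

    module ExchangeArgument
      (B : Fin k → ℕ) (BT : ℕ)
      (xs : ℕ → Sol n k) (es : ℕ → Fin n) (is : ℕ → Fin k) (run : GreedyRun R B BT F xs es is)
      (o : Sol n k) (cnt-o : ∀ l → cnt o l ≡ B l) (os : ℕ → Sol n k) (os0 : os zero ≡ o)
      (steps : ∀ j → j ℕ.< BT → ConstrStep (xs j) (es (suc j)) (is (suc j)) (os j) (os (suc j)))
      where
      open GreedyRunProperties B BT F xs es is run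

      Invariant : ℕ → Set
      Invariant j = xs j ⪯ os j × (∀ l → cnt (os j) l ≡ B l)

      exchange : ∀ {j} → j ℕ.< BT → Invariant j →
                 Exchange (xs j) (es (suc j)) (is (suc j)) (os j) (os (suc j))
      exchange {j} j<BT (x⪯o , _) = constrStep⇒exchange x⪯o (greedy-free j<BT) (steps j j<BT)

      invariant : ∀ j → j ℕ.≤ BT → Invariant j
      invariant zero _ rewrite proj₁ run | os0 = zeroSol-⪯ o , cnt-o
      invariant (suc j) j<BT =
        subst (_⪯ os (suc j)) (sym (greedy-next j<BT)) (exchange-⪯ ex) ,
        λ l → trans (exchange-cnt ex l) (proj₂ inv l)
        where
        inv : Invariant j
        inv = invariant j (ℕₚ.<⇒≤ j<BT)
        ex : Exchange (xs j) (es (suc j)) (is (suc j)) (os j) (os (suc j))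
        ex = exchange j<BT inv

      exchange-bound : ∀ {j o o′} → j ℕ.< BT → xs j ⪯ o → (∀ l → cnt o l ≡ B l) →
                       Exchange (xs j) (es (suc j)) (is (suc j)) o o′ →
                       (ρ * (F o - F o′)) ≤ (2# * (F (xs (suc j)) - F (xs j)))
      exchange-bound {j} {o} {o′} j<BT x⪯o cnt≡B ex rewrite greedy-next j<BT = begin
        ρ * (F o - F o′) ≤⟨ bound ex ⟩
        G + G            ≈⟨ 2*x≈x+x G ⟨
        2# * G           ∎
        where
        x : Sol n k
        x = xs j
        e : Fin n
        e = es (suc j)
        i : Fin k
        i = is (suc j)
        G : Carrier
        G = Δ R F x e i
        greedy : ∀ {u} l → NotInSupp x u → avail B xs is j l ≡ true → Δ R F x u l ≤ G
        greedy l = greedy-max j<BT _ l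
        bound : Exchange x e i o o′ → (ρ * (F o - F o′)) ≤ (G + G)
        bound (single a u x⪯a ae au refl refl) = begin
          ρ * (F (add a u i) - F (add a e i)) ≤⟨ single-exchange x a i i x⪯a ae au ⟩
          Δ R F x u i                         ≤⟨ greedy i xu (greedy-avail j<BT) ⟩
          G                                   ≤⟨ x≤x+y (ΔF-nonneg x i (greedy-free j<BT)) ⟩
          G + G                               ∎
          where
          xu : NotInSupp x u
          xu = ⪯-notInSupp x a x⪯a au
        bound (double a u l e≢u x⪯a ae au refl refl) = begin
          ρ * (F (add (add a e l) u i) - F (add (add a e i) u l))
            ≤⟨ double-exchange x a i l e≢u x⪯a ae au ⟩
          Δ R F x u i + Δ R F x e l
            ≤⟨ +-mono-≤ (greedy i xu (greedy-avail j<BT)) (greedy l (greedy-free j<BT) l-avail) ⟩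
          G + G
            ∎
          where
          xu : NotInSupp x u
          xu = ⪯-notInSupp x a x⪯a au
          l-avail : avail B xs is j l ≡ true
          l-avail = unsaturated⇒avail (ℕₚ.<⇒≤ j<BT)
            (ℕₚ.<-≤-trans (cnt-strict x (add (add a e l) u i) x⪯o (exchange-label a l i e≢u)
                                      (greedy-free j<BT))
                          (ℕₚ.≤-reflexive (cnt≡B l)))

      step-bound : ∀ {j} → j ℕ.< BT →
                   (ρ * (F (os j) - F (os (suc j)))) ≤ (2# * (F (xs (suc j)) - F (xs j)))
      step-bound {j} j<BT with invariant j (ℕₚ.<⇒≤ j<BT)
      ... | inv@(x⪯o , cnt≡B) = exchange-bound j<BT x⪯o cnt≡B (exchange j<BT inv)

open import Data.Nat using (_<_; _≤_)

lemma4 : (R : OrderedField) → (n k : ℕ) → 1 ≤ k →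
    (ε : OrderedField.Carrier R) →
    OrderedField._<_ R (OrderedField.0# R) ε → OrderedField._<_ R ε (OrderedField.1# R) →
    (B : Fin k → ℕ) → (∀ i → 1 ≤ B i) →
    (BT : ℕ) → BT ≡ sumFin B → BT ≤ n →
    (F : Sol n k → OrderedField.Carrier R) →
    (∀ x → OrderedField._≤_ R (OrderedField.0# R) (F x)) →
    ApproxDR R ε F →
    (xs : ℕ → Sol n k) → (es : ℕ → Fin n) → (is : ℕ → Fin k) →
    GreedyRun R B BT F xs es is →
    (o : Sol n k) → Optimal R B F o → (∀ i → cnt o i ≡ B i) →
    (os : ℕ → Sol n k) → os zero ≡ o →
    (∀ j → j < BT → ConstrStep (xs j) (es (suc j)) (is (suc j)) (os j) (os (suc j))) →
    ∀ j → j < BT →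
      OrderedField._≤_ R
        (OrderedField._*_ R
          (OrderedField._/_ R (OrderedField._-_ R (OrderedField.1# R) ε)
                              (OrderedField._+_ R (OrderedField.1# R) ε))
          (OrderedField._-_ R (F (os j)) (F (os (suc j)))))
        (OrderedField._*_ R (OrderedField.2# R)
          (OrderedField._-_ R (F (xs (suc j))) (F (xs j))))
lemma4 R n k _ ε (0≤ε , _) (ε≤1 , _) B _ BT _ _ F _ (_ , f , f-mono , (f-dim , _) , _ , F≈f)
       xs es is run o _ cnt-o os os0 steps j j<BT =
  step-bound j<BT
  where
  open ApproximateDiminishingReturns.ExchangeArgument
         R ε 0≤ε ε≤1 F f f-mono f-dim F≈f B BT xs es is run o cnt-o os os0 steps
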